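{- For positive integers $a,b$, there exists a graph $G$ with $\chi_{\mathrm{gp}}(G)=a$ and $\chi_{\mathrm{mp}}(G)=b$ if and only if $a=b=1$ or $2\le a\le b$.
   Context: A set $S$ is in general position (resp. monophonic position) if no shortest path (resp. induced path) of the graph contains more than two vertices of $S$. $\chi_{\mathrm{gp}}(G)$ (resp. $\chi_{\mathrm{mp}}(G)$) is the minimum number of colours in a colouring of $V(G)$ where each colour class is in general (resp. monophonic) position. -}

module Defs where

open import Data.Nat using (ℕ; zero; suc; _+_; _≤_; _<_)
open import Data.Fin using (Fin; toℕ; inject₁; fromℕ)
open import Data.Bool using (Bool; true; false)
open import Data.Product using (Σ; _×_; ∃-syntax)
open import Relation.Binary.PropositionalEquality using (_≡_)
open import Relation.Nullary using (¬_)
open import Function.Definitions using (Injective)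

record Graph (n : ℕ) : Set where
  field
    adj     : Fin n → Fin n → Bool
    sym     : ∀ u v → adj u v ≡ adj v u
    irrefl  : ∀ v → adj v v ≡ false

open Graph public

module _ {n : ℕ} (G : Graph n) where

  IsPath : (k : ℕ) → (Fin (suc k) → Fin n) → Set
  IsPath k p = (∀ (i : Fin k) → adj G (p (inject₁ i)) (p (Fin.suc i)) ≡ true)
             × Injective _≡_ _≡_ p

  IsShortestPath : (k : ℕ) → (Fin (suc k) → Fin n) → Set
  IsShortestPath k p = IsPath k p ×
    (∀ (m : ℕ) (q : Fin (suc m) → Fin n) → IsPath m q →
       q Fin.zero ≡ p Fin.zero → q (fromℕ m) ≡ p (fromℕ k) → k ≤ m)

  IsInducedPath : (k : ℕ) → (Fin (suc k) → Fin n) → Set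
  IsInducedPath k p = IsPath k p ×
    (∀ (i j : Fin (suc k)) → suc (suc (toℕ i)) ≤ toℕ j → adj G (p i) (p j) ≡ false)

  ThreeOnPath : (S : Fin n → Set) (k : ℕ) → (Fin (suc k) → Fin n) → Set
  ThreeOnPath S k p = ∃[ i ] ∃[ j ] ∃[ l ]
    (toℕ i < toℕ j × toℕ j < toℕ l × S (p i) × S (p j) × S (p l))

  InGeneralPosition : (Fin n → Set) → Set
  InGeneralPosition S = ∀ (k : ℕ) (p : Fin (suc k) → Fin n) →
    IsShortestPath k p → ¬ ThreeOnPath S k p

  InMonophonicPosition : (Fin n → Set) → Set
  InMonophonicPosition S = ∀ (k : ℕ) (p : Fin (suc k) → Fin n) →
    IsInducedPath k p → ¬ ThreeOnPath S k p

  ColourClass : {c : ℕ} → (Fin n → Fin c) → Fin c → Fin n → Set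
  ColourClass f x v = f v ≡ x

  GpColouring : ℕ → Set
  GpColouring c = Σ (Fin n → Fin c) λ f → ∀ x → InGeneralPosition (ColourClass f x)

  MpColouring : ℕ → Set
  MpColouring c = Σ (Fin n → Fin c) λ f → ∀ x → InMonophonicPosition (ColourClass f x)

  ChiGpIs : ℕ → Set
  ChiGpIs a = GpColouring a × (∀ c → c < a → ¬ GpColouring c)

  ChiMpIs : ℕ → Set
  ChiMpIs b = MpColouring b × (∀ c → c < b → ¬ MpColouring c)

module Submission where

-- Let G be the disjoint union of the path on 2a vertices and the crown graph on 2m vertices
-- (K_{m,m} minus a perfect matching). Colouring the i-th path vertex by ⌊i/2⌋ and the crown by
-- its two sides is a gp-colouring with a colours: a geodesic of the crown has at most three
-- edges and each side is independent. Colouring the crown by matching index instead gives an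
-- mp-colouring with max(a, m) colours, since then every colour class meets each component in
-- at most two vertices. Fewer than a colours put three equally coloured vertices on a segment
-- of the path, which is a geodesic; fewer than m ≥ 3 colours put three on the crown, where any
-- three vertices lie on an induced path (a prefix of an alternating walk p q w p q).
-- Conversely, shortest paths are induced, so mp-colourings are gp-colourings and χ_gp ≤ χ_mp;
-- and an induced path on three vertices is a shortest path, so χ_gp = 1 forces χ_mp = 1.

open import Defs hiding (sym)
open import Data.Bool using (Bool; true; false; not; _∧_; _∨_; _xor_; if_then_else_)
open import Data.Bool.Properties as Bool using (∨-comm; ∧-zeroʳ; not-¬; ¬-not)
open import Data.Empty using (⊥)
open import Data.Fin
  using (Fin; toℕ; inject₁; inject≤; fromℕ; fromℕ<; join; splitAt; punchIn; punchOut; _≟_)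
open import Data.Fin.Induction using (<-weakInduction)
open import Data.Fin.Patterns using (0F; 1F; 2F; 3F; 4F)
open import Data.Fin.Properties as Fin
  using (any?; all?; <-cmp; injective⇒≤; splitAt-join; toℕ-injective; toℕ-inject₁; toℕ-inject≤;
         inject≤-injective; toℕ-fromℕ<; toℕ-fromℕ; toℕ<n; +↔⊎; *↔×; 2↔Bool;
         punchInᵢ≢i; punchIn-injective; punchIn-punchOut)
open import Data.Nat using (ℕ; zero; suc; _+_; _*_; _∸_; _≤_; _<_; z≤n; s≤s; _≤?_; ⌊_/2⌋)
open import Data.Nat.Properties as ℕ
  using (≤-refl; ≤-trans; ≤-reflexive; ≤-pred; <-trans; <-irrefl; <⇒≤; <⇒≱; ≮⇒≥; ≤-antisym;
         ≤-<-trans; <-≤-trans; n≤1+n; m≤m+n; m≤n+m; m<m+n; 1+n≢n; m≤n⇒m<n∨m≡n;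
         +-suc; +-identityʳ; +-mono-<; +-monoʳ-≤; +-monoˡ-≤; +-cancelˡ-≡; +-cancelʳ-≡;
         +-cancelˡ-≤; +-cancelʳ-≤; m+[n∸m]≡n; m∸n+n≡m; m+n∸m≡n; ∸-monoˡ-≤; m<n⇒0<n∸m)
open import Data.Product using (Σ; _×_; _,_; proj₁; proj₂; ∃)
open import Data.Product.Function.NonDependent.Propositional using (_×-↔_)
open import Data.Product.Properties using (≡-dec)
open import Data.Sum using (_⊎_; inj₁; inj₂; [_,_]′)
open import Data.Sum.Function.Propositional using (_⊎-↔_)
open import Data.Sum.Properties using (inj₁-injective; inj₂-injective)
open import Data.Unit using (tt)
open import Function using (_∘_; const; _↔_; Inverse; Injection; _⇔_; mk⇔)
open import Function.Properties.Inverse using (↔-refl; ↔-trans; Inverse⇒Injection)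
open import Relation.Binary using (tri<; tri≈; tri>)
open import Relation.Binary.PropositionalEquality
  using (_≡_; _≢_; refl; sym; trans; cong; cong₂; subst; subst₂; module ≡-Reasoning)
open import Relation.Nullary using (¬_; Dec; yes; no; does; contradiction; ¬?; _×-dec_; _⊎-dec_; _→-dec_)
open import Relation.Nullary.Decidable using (toWitness; dec-true; dec-false; does-⇔)

open ≡-Reasoning

module _ {n c : ℕ} (f : Fin n → Fin c) where

  MonochromaticTriple : Set
  MonochromaticTriple = ∃ λ i → ∃ λ j → ∃ λ l →
    toℕ i < toℕ j × toℕ j < toℕ l × f i ≡ f j × f j ≡ f l

  private
    Repeated : Fin n → Set
    Repeated t = ∃ λ s → toℕ s < toℕ t × f s ≡ f t

    repeated? : ∀ t → Dec (Repeated t)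
    repeated? t = any? λ s → (toℕ s ℕ.<? toℕ t) ×-dec (f s Fin.≟ f t)

    -- Tagging each element with whether its colour already occurred earlier
    -- is injective as soon as no colour occurs three times.
    tag : Fin n → Fin c ⊎ Fin c
    tag t = if does (repeated? t) then inj₂ (f t) else inj₁ (f t)

    tag-injective : ¬ MonochromaticTriple → ∀ {t t'} → tag t ≡ tag t' → t ≡ t'
    tag-injective none {t} {t'} eq with repeated? t | repeated? t' | <-cmp t t'
    ... | _ | _ | tri≈ _ t≡t' _ = t≡t'
    ... | yes (s , s<t , fs≡ft) | yes _ | tri< t<t' _ _ =
      contradiction (s , t , t' , s<t , t<t' , fs≡ft , inj₂-injective eq) none
    ... | yes _ | yes (s , s<t' , fs≡ft') | tri> _ _ t'<t =
      contradiction (s , t' , t , s<t' , t'<t , fs≡ft' , sym (inj₂-injective eq)) none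
    ... | no _ | no ¬r' | tri< t<t' _ _ = contradiction (t , t<t' , inj₁-injective eq) ¬r'
    ... | no ¬r | no _ | tri> _ _ t'<t = contradiction (t' , t'<t , sym (inj₁-injective eq)) ¬r

  pigeonhole₃ : c + c < n → MonochromaticTriple
  pigeonhole₃ 2c<n with any? (λ i → any? λ j → any? λ l →
    (toℕ i ℕ.<? toℕ j) ×-dec (toℕ j ℕ.<? toℕ l) ×-dec (f i Fin.≟ f j) ×-dec (f j Fin.≟ f l))
  ... | yes triple = triple
  ... | no none = contradiction (injective⇒≤ join∘tag-injective) (<⇒≱ 2c<n)
    where
    join∘tag-injective : ∀ {t t'} → join c c (tag t) ≡ join c c (tag t') → t ≡ t'
    join∘tag-injective {t} {t'} eq = tag-injective none
      (trans (sym (splitAt-join c c (tag t))) (trans (cong (splitAt c) eq) (splitAt-join c c (tag t'))))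

AtMostTwo : ∀ {A : Set} → (A → Set) → Set
AtMostTwo S = ∀ {u v w} → S u → S v → S w → u ≢ v → u ≢ w → v ≢ w → ⊥

atMostTwo-map : ∀ {A B : Set} {S : A → Set} {T : B → Set} (g : A → B) →
  (∀ {u v} → S u → S v → g u ≡ g v → u ≡ v) → (∀ {u} → S u → T (g u)) → AtMostTwo T → AtMostTwo S
atMostTwo-map g injective-on-S S⇒T atMostTwo Su Sv Sw u≢v u≢w v≢w = atMostTwo (S⇒T Su) (S⇒T Sv) (S⇒T Sw)
  (u≢v ∘ injective-on-S Su Sv) (u≢w ∘ injective-on-S Su Sw) (v≢w ∘ injective-on-S Sv Sw)

atMostTwo-twoValues : ∀ {A : Set} (α β : A) → AtMostTwo (λ x → x ≡ α ⊎ x ≡ β)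
atMostTwo-twoValues α β (inj₁ refl) (inj₁ refl) _ u≢v _ _ = u≢v refl
atMostTwo-twoValues α β (inj₂ refl) (inj₂ refl) _ u≢v _ _ = u≢v refl
atMostTwo-twoValues α β (inj₁ refl) (inj₂ refl) (inj₁ refl) _ u≢w _ = u≢w refl
atMostTwo-twoValues α β (inj₂ refl) (inj₁ refl) (inj₂ refl) _ u≢w _ = u≢w refl
atMostTwo-twoValues α β (inj₁ refl) (inj₂ refl) (inj₂ refl) _ _ v≢w = v≢w refl
atMostTwo-twoValues α β (inj₂ refl) (inj₁ refl) (inj₁ refl) _ _ v≢w = v≢w refl

⌊n/2⌋-fibre : ∀ x → x ≡ ⌊ x /2⌋ + ⌊ x /2⌋ ⊎ x ≡ suc (⌊ x /2⌋ + ⌊ x /2⌋)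
⌊n/2⌋-fibre 0 = inj₁ refl
⌊n/2⌋-fibre 1 = inj₂ refl
⌊n/2⌋-fibre (suc (suc x)) with ⌊n/2⌋-fibre x
... | inj₁ even = inj₁ (cong suc (trans (cong suc even) (sym (+-suc ⌊ x /2⌋ ⌊ x /2⌋))))
... | inj₂ odd = inj₂ (cong suc (trans (cong suc odd) (cong suc (sym (+-suc ⌊ x /2⌋ ⌊ x /2⌋)))))

⌊n/2⌋-atMostTwo : ∀ q → AtMostTwo (λ x → ⌊ x /2⌋ ≡ q)
⌊n/2⌋-atMostTwo q hu hv hw = atMostTwo-twoValues (q + q) (suc (q + q)) (fibre hu) (fibre hv) (fibre hw)
  where
  fibre : ∀ {x} → ⌊ x /2⌋ ≡ q → x ≡ q + q ⊎ x ≡ suc (q + q)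
  fibre {x} refl = ⌊n/2⌋-fibre x

⌊n/2⌋<m : ∀ {m n} → n < m + m → ⌊ n /2⌋ < m
⌊n/2⌋<m {suc m} {0} _ = s≤s z≤n
⌊n/2⌋<m {suc m} {1} _ = s≤s z≤n
⌊n/2⌋<m {suc m} {suc (suc n)} (s≤s 2+n≤m+1+m) =
  s≤s (⌊n/2⌋<m (≤-pred (subst (suc (suc n) ≤_) (+-suc m m) 2+n≤m+1+m)))

Visits : ∀ {A : Set} {k} → (Fin (suc k) → A) → A → Set
Visits p u = ∃ λ t → p t ≡ u

prefix : ∀ {A : Set} {j k} → j ≤ k → (Fin (suc k) → A) → Fin (suc j) → A
prefix j≤k p t = p (inject≤ t (s≤s j≤k))

-- Geodesics and induced paths

module _ {n : ℕ} (G : Graph n) where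

  OneLipschitz : (Fin n → ℕ) → Set
  OneLipschitz φ = ∀ u v → adj G u v ≡ true → φ v ≤ suc (φ u)

  module _ {k : ℕ} {p : Fin (suc k) → Fin n} (path : IsPath G k p) where

    path-invariant : ∀ {L : Set} (κ : Fin n → L) → (∀ u v → adj G u v ≡ true → κ u ≡ κ v) →
                     ∀ t → κ (p t) ≡ κ (p 0F)
    path-invariant κ edge-invariant = <-weakInduction (λ t → κ (p t) ≡ κ (p 0F)) refl
      λ t κt≡κ₀ → trans (sym (edge-invariant _ _ (proj₁ path t))) κt≡κ₀

    potential-bound : ∀ φ → OneLipschitz φ → ∀ t → φ (p t) ≤ φ (p 0F) + toℕ t
    potential-bound φ lip = <-weakInduction (λ t → φ (p t) ≤ φ (p 0F) + toℕ t)
      (≤-reflexive (sym (+-identityʳ _)))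
      λ t bound → ≤-trans (lip _ _ (proj₁ path t))
        (≤-trans (s≤s (subst (λ x → φ (p (inject₁ t)) ≤ φ (p 0F) + x) (toℕ-inject₁ t) bound))
                 (≤-reflexive (sym (+-suc _ _))))

    adjacent-positions : ∀ x y → toℕ y ≡ suc (toℕ x) → adj G (p x) (p y) ≡ true
    adjacent-positions x y y≡1+x =
      subst₂ (λ u v → adj G (p u) (p v) ≡ true) inject₁t≡x suct≡y (proj₁ path t)
      where
      x<k : toℕ x < k
      x<k = ≤-pred (subst (_< suc k) y≡1+x (toℕ<n y))
      t : Fin k
      t = fromℕ< x<k
      inject₁t≡x : inject₁ t ≡ x
      inject₁t≡x = toℕ-injective (trans (toℕ-inject₁ t) (toℕ-fromℕ< x<k))
      suct≡y : Fin.suc t ≡ y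
      suct≡y = toℕ-injective (trans (cong suc (toℕ-fromℕ< x<k)) (sym y≡1+x))

  potential-geodesic : ∀ {k p} φ → OneLipschitz φ → IsPath G k p →
                       φ (p (fromℕ k)) ≡ φ (p 0F) + k → IsShortestPath G k p
  potential-geodesic {k} {p} φ lip path climbs = path , shortest
    where
    shortest : ∀ m q → IsPath G m q → q 0F ≡ p 0F → q (fromℕ m) ≡ p (fromℕ k) → k ≤ m
    shortest m q q-path q₀ qₘ =
      +-cancelˡ-≤ (φ (p 0F)) k m (subst₂ _≤_ φ-end φ-start (potential-bound q-path φ lip (fromℕ m)))
      where
      φ-end : φ (q (fromℕ m)) ≡ φ (p 0F) + k
      φ-end = trans (cong φ qₘ) climbs
      φ-start : φ (q 0F) + toℕ (fromℕ m) ≡ φ (p 0F) + m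
      φ-start = cong₂ _+_ (cong φ q₀) (toℕ-fromℕ m)

  -- A chord between positions i and j lets a path skip the d = j - i - 1 positions in between.
  module Shortcut {k : ℕ} {p : Fin (suc k) → Fin n} (path : IsPath G k p)
                  (i j : Fin (suc k)) (gap : suc (toℕ i) < toℕ j) (chord : adj G (p i) (p j) ≡ true) where

    I = toℕ i
    d = toℕ j ∸ suc I
    m = k ∸ d

    1+i+d≡j : suc I + d ≡ toℕ j
    1+i+d≡j = m+[n∸m]≡n (<⇒≤ gap)

    1+i+d≤k : suc I + d ≤ k
    1+i+d≤k = ≤-trans (≤-reflexive 1+i+d≡j) (≤-pred (toℕ<n j))

    m+d≡k : m + d ≡ k
    m+d≡k = m∸n+n≡m (≤-trans (m≤n+m d (suc I)) 1+i+d≤k)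

    i<m : I < m
    i<m = +-cancelʳ-≤ d (suc I) m (≤-trans 1+i+d≤k (≤-reflexive (sym m+d≡k)))

    m<k : m < k
    m<k = ≤-trans (m<m+n m (m<n⇒0<n∸m gap)) (≤-reflexive m+d≡k)

    skip : ℕ → ℕ
    skip x with x ≤? I
    ... | yes _ = x
    ... | no _ = x + d

    skip-≤ : ∀ x → x ≤ I → skip x ≡ x
    skip-≤ x x≤i with x ≤? I
    ... | yes _ = refl
    ... | no x≰i = contradiction x≤i x≰i

    skip-> : ∀ x → I < x → skip x ≡ x + d
    skip-> x i<x with x ≤? I
    ... | yes x≤i = contradiction x≤i (<⇒≱ i<x)
    ... | no _ = refl

    skip-injective : ∀ x y → skip x ≡ skip y → x ≡ y
    skip-injective x y eq with x ≤? I | y ≤? I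
    ... | yes _ | yes _ = eq
    ... | no _ | no _ = +-cancelʳ-≡ d x y eq
    ... | yes x≤i | no y≰i = contradiction (≤-trans (subst (y ≤_) (sym eq) (m≤m+n y d)) x≤i) y≰i
    ... | no x≰i | yes y≤i = contradiction (≤-trans (subst (x ≤_) eq (m≤m+n x d)) y≤i) x≰i

    skip-bound : ∀ x → x ≤ m → skip x < suc k
    skip-bound x x≤m with x ≤? I
    ... | yes x≤i = s≤s (≤-trans x≤i (≤-trans (m≤m+n I (suc d)) (subst (_≤ k) (sym (+-suc I d)) 1+i+d≤k)))
    ... | no _ = s≤s (≤-trans (+-monoˡ-≤ d x≤m) (≤-reflexive m+d≡k))

    position : Fin (suc m) → Fin (suc k)
    position s = fromℕ< (skip-bound (toℕ s) (≤-pred (toℕ<n s)))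

    toℕ-position : ∀ s → toℕ (position s) ≡ skip (toℕ s)
    toℕ-position s = toℕ-fromℕ< (skip-bound (toℕ s) (≤-pred (toℕ<n s)))

    position-step : ∀ t → adj G (p (position (inject₁ t))) (p (position (Fin.suc t))) ≡ true
    position-step t with ℕ.<-cmp (toℕ t) I
    ... | tri< t<i _ _ = adjacent-positions path _ _ (begin
      toℕ (position (Fin.suc t))    ≡⟨ toℕ-position (Fin.suc t) ⟩
      skip (suc (toℕ t))            ≡⟨ skip-≤ (suc (toℕ t)) t<i ⟩
      suc (toℕ t)                   ≡⟨ cong suc (skip-≤ (toℕ t) (<⇒≤ t<i)) ⟨
      suc (skip (toℕ t))            ≡⟨ cong (suc ∘ skip) (toℕ-inject₁ t) ⟨
      suc (skip (toℕ (inject₁ t)))  ≡⟨ cong suc (toℕ-position (inject₁ t)) ⟨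
      suc (toℕ (position (inject₁ t))) ∎)
    ... | tri> _ _ i<t = adjacent-positions path _ _ (begin
      toℕ (position (Fin.suc t))    ≡⟨ toℕ-position (Fin.suc t) ⟩
      skip (suc (toℕ t))            ≡⟨ skip-> (suc (toℕ t)) (≤-trans i<t (n≤1+n _)) ⟩
      suc (toℕ t + d)               ≡⟨ cong suc (skip-> (toℕ t) i<t) ⟨
      suc (skip (toℕ t))            ≡⟨ cong (suc ∘ skip) (toℕ-inject₁ t) ⟨
      suc (skip (toℕ (inject₁ t)))  ≡⟨ cong suc (toℕ-position (inject₁ t)) ⟨
      suc (toℕ (position (inject₁ t))) ∎)
    ... | tri≈ _ t≡i _ = subst₂ (λ u v → adj G (p u) (p v) ≡ true) (sym at-i) (sym at-j) chord
      where
      at-i : position (inject₁ t) ≡ i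
      at-i = toℕ-injective (begin
        toℕ (position (inject₁ t))  ≡⟨ toℕ-position (inject₁ t) ⟩
        skip (toℕ (inject₁ t))      ≡⟨ cong skip (trans (toℕ-inject₁ t) t≡i) ⟩
        skip I                      ≡⟨ skip-≤ I ≤-refl ⟩
        I                           ∎)
      at-j : position (Fin.suc t) ≡ j
      at-j = toℕ-injective (begin
        toℕ (position (Fin.suc t))  ≡⟨ toℕ-position (Fin.suc t) ⟩
        skip (suc (toℕ t))          ≡⟨ cong (skip ∘ suc) t≡i ⟩
        skip (suc I)                ≡⟨ skip-> (suc I) ≤-refl ⟩
        suc I + d                   ≡⟨ 1+i+d≡j ⟩
        toℕ j                       ∎)

    q : Fin (suc m) → Fin n
    q = p ∘ position

    q-path : IsPath G m q
    q-path = position-step , λ {s} {s'} eq → toℕ-injective (skip-injective (toℕ s) (toℕ s')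
               (trans (sym (toℕ-position s)) (trans (cong toℕ (proj₂ path eq)) (toℕ-position s'))))

    q-start : q 0F ≡ p 0F
    q-start = cong p (toℕ-injective (trans (toℕ-position 0F) (skip-≤ 0 z≤n)))

    q-end : q (fromℕ m) ≡ p (fromℕ k)
    q-end = cong p (toℕ-injective (trans (toℕ-position (fromℕ m))
              (trans (cong skip (toℕ-fromℕ m)) (trans (skip-> m i<m) (trans m+d≡k (sym (toℕ-fromℕ k)))))))

  shortest⇒induced : ∀ {k p} → IsShortestPath G k p → IsInducedPath G k p
  shortest⇒induced {k} {p} (path , shortest) = path , no-chord
    where
    no-chord : ∀ i j → suc (suc (toℕ i)) ≤ toℕ j → adj G (p i) (p j) ≡ false
    no-chord i j gap with adj G (p i) (p j) in chord
    ... | false = refl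
    ... | true = contradiction (shortest m q q-path q-start q-end) (<⇒≱ m<k)
      where open Shortcut path i j gap chord

  isPath-prefix : ∀ {j k p} (j≤k : j ≤ k) → IsPath G k p → IsPath G j (prefix j≤k p)
  isPath-prefix {p = p} j≤k path = step , λ eq → inject≤-injective _ _ _ _ (proj₂ path eq)
    where
    step : ∀ t → adj G (prefix j≤k p (inject₁ t)) (prefix j≤k p (Fin.suc t)) ≡ true
    step t = adjacent-positions path _ _
      (cong suc (trans (toℕ-inject≤ t _) (sym (trans (toℕ-inject≤ (inject₁ t) _) (toℕ-inject₁ t)))))

  isInducedPath-prefix : ∀ {j k p} (j≤k : j ≤ k) → IsInducedPath G k p → IsInducedPath G j (prefix j≤k p)
  isInducedPath-prefix j≤k (path , chordless) = isPath-prefix j≤k path , λ x y gap →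
    chordless _ _ (subst₂ (λ u v → suc (suc u) ≤ v) (sym (toℕ-inject≤ x _)) (sym (toℕ-inject≤ y _)) gap)

  isInducedPath₂⇒isShortestPath : ∀ {p} → IsInducedPath G 2 p → IsShortestPath G 2 p
  isInducedPath₂⇒isShortestPath {p} ((step , injective) , chordless) = (step , injective) , shortest
    where
    shortest : ∀ m q → IsPath G m q → q 0F ≡ p 0F → q (fromℕ m) ≡ p (fromℕ 2) → 2 ≤ m
    shortest zero q _ q₀ q₂ with () ← injective (trans (sym q₀) q₂)
    shortest 1 q (q-step , _) q₀ q₁
      with () ← trans (sym (q-step 0F)) (trans (cong₂ (adj G) q₀ q₁) (chordless 0F (fromℕ 2) ≤-refl))
    shortest (suc (suc m)) _ _ _ _ = s≤s (s≤s z≤n)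

  inMonophonicPosition⇒inGeneralPosition : ∀ {S} → InMonophonicPosition G S → InGeneralPosition G S
  inMonophonicPosition⇒inGeneralPosition mp k p = mp k p ∘ shortest⇒induced

  mpColouring⇒gpColouring : ∀ {c} → MpColouring G c → GpColouring G c
  mpColouring⇒gpColouring (f , mp) = f , λ x → inMonophonicPosition⇒inGeneralPosition {ColourClass G f x} (mp x)

  threeOnPath⇒2≤k : ∀ S {k p} → ThreeOnPath G S k p → 2 ≤ k
  threeOnPath⇒2≤k S (i , j , l , i<j , j<l , _) =
    ≤-trans (s≤s (≤-trans (s≤s z≤n) i<j)) (≤-trans j<l (≤-pred (toℕ<n l)))

  -- The first three vertices of an induced path form a shortest path.
  everywhere-gp⇒mp : ∀ {S} → (∀ v → S v) → InGeneralPosition G S → InMonophonicPosition G S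
  everywhere-gp⇒mp {S} everywhere gp k p induced three =
    gp 2 (prefix 2≤k p) (isInducedPath₂⇒isShortestPath (isInducedPath-prefix 2≤k induced))
      (0F , 1F , 2F , s≤s z≤n , s≤s (s≤s z≤n) , everywhere _ , everywhere _ , everywhere _)
    where
    2≤k = threeOnPath⇒2≤k S three

  module _ {S : Fin n → Set} {k : ℕ} {p : Fin (suc k) → Fin n} where

    private
      insert : ∀ {i j l} → toℕ i < toℕ j → l ≢ i → l ≢ j → S (p i) → S (p j) → S (p l) →
               ThreeOnPath G S k p
      insert {i} {j} {l} i<j l≢i l≢j Si Sj Sl with <-cmp l i | <-cmp l j
      ... | tri< l<i _ _ | _ = l , i , j , l<i , i<j , Sl , Si , Sj
      ... | tri> _ _ i<l | tri< l<j _ _ = i , l , j , i<l , l<j , Si , Sl , Sj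
      ... | tri> _ _ _ | tri> _ _ j<l = i , j , l , i<j , j<l , Si , Sj , Sl
      ... | tri≈ _ l≡i _ | _ = contradiction l≡i l≢i
      ... | _ | tri≈ _ l≡j _ = contradiction l≡j l≢j

    threeOnPath-unordered : ∀ i j l → i ≢ j → i ≢ l → j ≢ l → S (p i) → S (p j) → S (p l) →
                            ThreeOnPath G S k p
    threeOnPath-unordered i j l i≢j i≢l j≢l Si Sj Sl with <-cmp i j
    ... | tri< i<j _ _ = insert i<j (i≢l ∘ sym) (j≢l ∘ sym) Si Sj Sl
    ... | tri> _ _ j<i = insert j<i (j≢l ∘ sym) (i≢l ∘ sym) Sj Si Sl
    ... | tri≈ _ i≡j _ = contradiction i≡j i≢j

    threeOnPath-restrict : ∀ {T : Fin n → Set} → (∀ t → T (p t)) → ThreeOnPath G S k p →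
                           ThreeOnPath G (λ v → S v × T v) k p
    threeOnPath-restrict onT (i , j , l , i<j , j<l , Si , Sj , Sl) =
      i , j , l , i<j , j<l , (Si , onT i) , (Sj , onT j) , (Sl , onT l)

    atMostTwo⇒¬threeOnPath : IsPath G k p → AtMostTwo S → ¬ ThreeOnPath G S k p
    atMostTwo⇒¬threeOnPath (_ , injective) atMostTwo (i , j , l , i<j , j<l , Si , Sj , Sl) =
      atMostTwo Si Sj Sl (distinct i<j) (distinct (<-trans i<j j<l)) (distinct j<l)
      where
      distinct : ∀ {x y} → toℕ x < toℕ y → p x ≢ p y
      distinct x<y px≡py = <-irrefl (cong toℕ (injective px≡py)) x<y

  Independent : (Fin n → Set) → Set
  Independent S = ∀ u v → S u → S v → adj G u v ≡ false

  independent⇒¬consecutive : ∀ {S k p} → Independent S → IsPath G k p →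
                             ∀ x y → toℕ y ≡ suc (toℕ x) → S (p x) → S (p y) → ⊥
  independent⇒¬consecutive independent path x y y≡1+x Sx Sy
    with () ← trans (sym (adjacent-positions path x y y≡1+x)) (independent _ _ Sx Sy)

  -- Among three positions of a path with at most four vertices, two are consecutive.
  independent⇒¬threeOnShortPath : ∀ {S k p} → Independent S → k ≤ 3 → IsPath G k p →
                                  ¬ ThreeOnPath G S k p
  independent⇒¬threeOnShortPath independent k≤3 path (i , j , l , i<j , j<l , Si , Sj , Sl)
    with m≤n⇒m<n∨m≡n i<j | m≤n⇒m<n∨m≡n j<l
  ... | inj₂ 1+i≡j | _ = independent⇒¬consecutive independent path i j (sym 1+i≡j) Si Sj
  ... | inj₁ _ | inj₂ 1+j≡l = independent⇒¬consecutive independent path j l (sym 1+j≡l) Sj Sl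
  ... | inj₁ 2+i≤j | inj₁ 2+j≤l
    with s≤s (s≤s (s≤s ())) ← ≤-trans (s≤s (s≤s (≤-trans (s≤s (s≤s z≤n)) 2+i≤j)))
                                      (≤-trans 2+j≤l (≤-trans (≤-pred (toℕ<n l)) k≤3))

  visits⇒threeOnPath : ∀ S {k p u v w} → Visits p u → Visits p v → Visits p w → u ≢ v → u ≢ w → v ≢ w →
                       S u → S v → S w → ThreeOnPath G S k p
  visits⇒threeOnPath S {k} {p} (i , refl) (j , refl) (l , refl) u≢v u≢w v≢w Su Sv Sw =
    threeOnPath-unordered {S} {k} {p} i j l (u≢v ∘ cong p) (u≢w ∘ cong p) (v≢w ∘ cong p) Su Sv Sw

  CommonShortestPath CommonInducedPath : Fin n → Fin n → Fin n → Set
  CommonShortestPath u v w = ∃ λ k → ∃ λ p → IsShortestPath G k p × Visits p u × Visits p v × Visits p w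
  CommonInducedPath u v w = ∃ λ k → ∃ λ p → IsInducedPath G k p × Visits p u × Visits p v × Visits p w

  commonShortestPath⇒¬gp : ∀ S {u v w} → CommonShortestPath u v w → u ≢ v → u ≢ w → v ≢ w →
                           S u → S v → S w → ¬ InGeneralPosition G S
  commonShortestPath⇒¬gp S (k , p , shortest , pu , pv , pw) u≢v u≢w v≢w Su Sv Sw gp =
    gp k p shortest (visits⇒threeOnPath S pu pv pw u≢v u≢w v≢w Su Sv Sw)

  commonInducedPath⇒¬mp : ∀ S {u v w} → CommonInducedPath u v w → u ≢ v → u ≢ w → v ≢ w →
                          S u → S v → S w → ¬ InMonophonicPosition G S
  commonInducedPath⇒¬mp S (k , p , induced , pu , pv , pw) u≢v u≢w v≢w Su Sv Sw mp =
    mp k p induced (visits⇒threeOnPath S pu pv pw u≢v u≢w v≢w Su Sv Sw)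

  endpoints-distinct : ∀ {k p} → IsPath G k p → 0 < k → p 0F ≢ p (fromℕ k)
  endpoints-distinct {suc k} (_ , injective) _ p₀≡pₖ with () ← injective p₀≡pₖ
-- The path–crown graph

consecutive : ℕ → ℕ → Bool
consecutive x y = does (suc x ℕ.≟ y) ∨ does (suc y ℕ.≟ x)

consecutive-sym : ∀ x y → consecutive x y ≡ consecutive y x
consecutive-sym x y = ∨-comm (does (suc x ℕ.≟ y)) (does (suc y ℕ.≟ x))

consecutive-irrefl : ∀ x → consecutive x x ≡ false
consecutive-irrefl x rewrite dec-false (suc x ℕ.≟ x) 1+n≢n = refl

consecutive-suc : ∀ x → consecutive x (suc x) ≡ true
consecutive-suc x rewrite dec-true (suc x ℕ.≟ suc x) refl = refl

consecutive⇒≤1+ : ∀ x y → consecutive x y ≡ true → y ≤ suc x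
consecutive⇒≤1+ x y adjacent with suc x ℕ.≟ y | suc y ℕ.≟ x
... | yes refl | _ = ≤-refl
... | no _ | yes refl = ≤-trans (n≤1+n y) (n≤1+n (suc y))
... | no 1+x≢y | no 1+y≢x
  with () ← trans (sym adjacent)
                  (cong₂ _∨_ (dec-false (suc x ℕ.≟ y) 1+x≢y) (dec-false (suc y ℕ.≟ x) 1+y≢x))

crownAdjacent : ∀ {m} → Bool × Fin m → Bool × Fin m → Bool
crownAdjacent (s , i) (s' , i') = not (does (s Bool.≟ s')) ∧ not (does (i Fin.≟ i'))

module _ {m : ℕ} where

  crownAdjacent-sym : ∀ (c c' : Bool × Fin m) → crownAdjacent c c' ≡ crownAdjacent c' c
  crownAdjacent-sym (s , i) (s' , i') =
    cong₂ (λ x y → not x ∧ not y) (does-⇔ (mk⇔ sym sym) (s Bool.≟ s') (s' Bool.≟ s))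
                                  (does-⇔ (mk⇔ sym sym) (i Fin.≟ i') (i' Fin.≟ i))

  crownAdjacent-sameSide : ∀ (c c' : Bool × Fin m) → proj₁ c ≡ proj₁ c' → crownAdjacent c c' ≡ false
  crownAdjacent-sameSide (s , _) _ refl rewrite dec-true (s Bool.≟ s) refl = refl

  crownAdjacent-sameIndex : ∀ (c c' : Bool × Fin m) → proj₂ c ≡ proj₂ c' → crownAdjacent c c' ≡ false
  crownAdjacent-sameIndex (_ , i) _ refl rewrite dec-true (i Fin.≟ i) refl = ∧-zeroʳ _

  crownAdjacent-true : ∀ {c c' : Bool × Fin m} → proj₁ c ≢ proj₁ c' → proj₂ c ≢ proj₂ c' →
                       crownAdjacent c c' ≡ true
  crownAdjacent-true {s , i} {s' , i'} s≢s' i≢i'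
    rewrite dec-false (s Bool.≟ s') s≢s' | dec-false (i Fin.≟ i') i≢i' = refl

-- A walk visiting the indices 0 1 2 0 1 of Fin 3, alternating between the
-- two sides; any three distinct crown vertices lie on a prefix of such a walk.
zigzag : Fin 5 → Bool × Fin 3
zigzag 0F = false , 0F
zigzag 1F = true , 1F
zigzag 2F = false , 2F
zigzag 3F = true , 0F
zigzag 4F = false , 1F

parity : Fin 5 → Bool
parity = proj₁ ∘ zigzag

letter : Fin 5 → Fin 3
letter = proj₂ ∘ zigzag

zigzag-injective : ∀ x y → zigzag x ≡ zigzag y → x ≡ y
zigzag-injective = toWitness {a? = all? λ x → all? λ y → ≡-dec Bool._≟_ _≟_ (zigzag x) (zigzag y) →-dec x ≟ y} tt

zigzag-steps : ∀ t → parity (inject₁ t) ≢ parity (Fin.suc t) × letter (inject₁ t) ≢ letter (Fin.suc t)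
zigzag-steps = toWitness {a? = all? λ t → ¬? (parity (inject₁ t) Bool.≟ parity (Fin.suc t))
                                         ×-dec ¬? (letter (inject₁ t) ≟ letter (Fin.suc t))} tt

zigzag-chords : ∀ i j → suc (suc (toℕ i)) ≤ toℕ j → parity i ≡ parity j ⊎ letter i ≡ letter j
zigzag-chords = toWitness {a? = all? λ i → all? λ j → suc (suc (toℕ i)) ℕ.≤? toℕ j
                                   →-dec (parity i Bool.≟ parity j ⊎-dec letter i ≟ letter j)} tt

xor-injectiveˡ : ∀ {b b'} s → b xor s ≡ b' xor s → b ≡ b'
xor-injectiveˡ {false} {false} s _ = refl
xor-injectiveˡ {true} {true} s _ = refl
xor-injectiveˡ {false} {true} s s≡¬s = contradiction s≡¬s (not-¬ refl)
xor-injectiveˡ {true} {false} s ¬s≡s = contradiction (sym ¬s≡s) (not-¬ refl)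

module _ {A : Set} (x y z : A) where

  three : Fin 3 → A
  three 0F = x
  three 1F = y
  three 2F = z

  three-injective : x ≢ y → x ≢ z → y ≢ z → ∀ {i j} → three i ≡ three j → i ≡ j
  three-injective _ _ _ {0F} {0F} _ = refl
  three-injective _ _ _ {1F} {1F} _ = refl
  three-injective _ _ _ {2F} {2F} _ = refl
  three-injective x≢y _ _ {0F} {1F} eq = contradiction eq x≢y
  three-injective _ x≢z _ {0F} {2F} eq = contradiction eq x≢z
  three-injective x≢y _ _ {1F} {0F} eq = contradiction (sym eq) x≢y
  three-injective _ _ y≢z {1F} {2F} eq = contradiction eq y≢z
  three-injective _ x≢z _ {2F} {0F} eq = contradiction (sym eq) x≢z
  three-injective _ _ y≢z {2F} {1F} eq = contradiction (sym eq) y≢z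

avoid₂ : ∀ {m} → 3 ≤ m → (i j : Fin m) → ∃ λ x → x ≢ i × x ≢ j
avoid₂ (s≤s (s≤s (s≤s _))) i j with i ≟ j
... | yes refl = punchIn i 0F , punchInᵢ≢i i 0F , punchInᵢ≢i i 0F
... | no i≢j = punchIn i (punchIn j' 0F) , punchInᵢ≢i i _ ,
               λ eq → punchInᵢ≢i j' 0F (punchIn-injective i _ _ (trans eq (sym (punchIn-punchOut i≢j))))
  where
  j' = punchOut i≢j

sideColour : ∀ {c} → .(2 ≤ c) → Bool → Fin c
sideColour 2≤c false = fromℕ< (≤-trans (s≤s z≤n) 2≤c)
sideColour 2≤c true = fromℕ< 2≤c

sideColour-injective : ∀ {c s s'} .{h h' : 2 ≤ c} → sideColour h s ≡ sideColour h' s' → s ≡ s'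
sideColour-injective {s = false} {false} _ = refl
sideColour-injective {s = true} {true} _ = refl
sideColour-injective {s = false} {true} eq
  with () ← trans (sym (toℕ-fromℕ< _)) (trans (cong toℕ eq) (toℕ-fromℕ< _))
sideColour-injective {s = true} {false} eq
  with () ← trans (sym (toℕ-fromℕ< _)) (trans (cong toℕ eq) (toℕ-fromℕ< _))

module PathCrown (a m : ℕ) where

  Vertex : Set
  Vertex = Fin (a + a) ⊎ (Bool × Fin m)

  adjacent : Vertex → Vertex → Bool
  adjacent (inj₁ t) (inj₁ t') = consecutive (toℕ t) (toℕ t')
  adjacent (inj₂ c) (inj₂ c') = crownAdjacent c c'
  adjacent _ _ = false

  N : ℕ
  N = (a + a) + 2 * m

  crownVertices : Fin (2 * m) ↔ (Bool × Fin m)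
  crownVertices = ↔-trans *↔× (2↔Bool ×-↔ ↔-refl)

  vertices : Fin N ↔ Vertex
  vertices = ↔-trans +↔⊎ (↔-refl ⊎-↔ crownVertices)

  open Inverse vertices public using (strictlyInverseˡ; strictlyInverseʳ) renaming (to to vertex; from to index)

  G : Graph N
  G = record
    { adj    = λ u v → adjacent (vertex u) (vertex v)
    ; sym    = λ u v → adjacent-sym (vertex u) (vertex v)
    ; irrefl = λ v → adjacent-irrefl (vertex v)
    }
    where
    adjacent-sym : ∀ v w → adjacent v w ≡ adjacent w v
    adjacent-sym (inj₁ t) (inj₁ t') = consecutive-sym (toℕ t) (toℕ t')
    adjacent-sym (inj₁ _) (inj₂ _) = refl
    adjacent-sym (inj₂ _) (inj₁ _) = refl
    adjacent-sym (inj₂ c) (inj₂ c') = crownAdjacent-sym c c'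
    adjacent-irrefl : ∀ v → adjacent v v ≡ false
    adjacent-irrefl (inj₁ t) = consecutive-irrefl (toℕ t)
    adjacent-irrefl (inj₂ c) = crownAdjacent-sameSide c c refl

  adj-index : ∀ v w → adj G (index v) (index w) ≡ adjacent v w
  adj-index v w = cong₂ adjacent (strictlyInverseˡ v) (strictlyInverseˡ w)

  pathVertex : Fin (a + a) → Fin N
  pathVertex = index ∘ inj₁

  crownVertex : Bool × Fin m → Fin N
  crownVertex = index ∘ inj₂

  adj-crownVertex : ∀ c c' → adj G (crownVertex c) (crownVertex c') ≡ crownAdjacent c c'
  adj-crownVertex c c' = adj-index (inj₂ c) (inj₂ c')

  index-injective : ∀ {v w} → index v ≡ index w → v ≡ w
  index-injective {v} {w} eq = trans (sym (strictlyInverseˡ v)) (trans (cong vertex eq) (strictlyInverseˡ w))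

  pathVertex-injective : ∀ {t t'} → pathVertex t ≡ pathVertex t' → t ≡ t'
  pathVertex-injective = inj₁-injective ∘ index-injective

  crownVertex-injective : ∀ {c c'} → crownVertex c ≡ crownVertex c' → c ≡ c'
  crownVertex-injective = inj₂-injective ∘ index-injective

  vertex-injective : ∀ {u v} → vertex u ≡ vertex v → u ≡ v
  vertex-injective {u} {v} eq = trans (sym (strictlyInverseʳ u)) (trans (cong index eq) (strictlyInverseʳ v))

  vertex≡⇒≡index : ∀ {u v} → vertex u ≡ v → u ≡ index v
  vertex≡⇒≡index {u} eq = trans (sym (strictlyInverseʳ u)) (cong index eq)

  InPath InCrown : Fin N → Set
  InPath u = ∃ λ t → vertex u ≡ inj₁ t
  InCrown u = ∃ λ c → vertex u ≡ inj₂ c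

  inCrown : Vertex → Bool
  inCrown = [ const false , const true ]′

  inCrown-invariant : ∀ {k p} → IsPath G k p → ∀ t → inCrown (vertex (p t)) ≡ inCrown (vertex (p 0F))
  inCrown-invariant path = path-invariant G path (inCrown ∘ vertex) λ u v → sameComponent (vertex u) (vertex v)
    where
    sameComponent : ∀ v w → adjacent v w ≡ true → inCrown v ≡ inCrown w
    sameComponent (inj₁ _) (inj₁ _) _ = refl
    sameComponent (inj₂ _) (inj₂ _) _ = refl

  path-within-component : ∀ {k p} → IsPath G k p → (∀ t → InPath (p t)) ⊎ (∀ t → InCrown (p t))
  path-within-component {k} {p} path with vertex (p 0F) in p₀
  ... | inj₁ _ = inj₁ λ t → inPath (vertex (p t)) (trans (inCrown-invariant path t) (cong inCrown p₀))
    where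
    inPath : ∀ v → inCrown v ≡ false → ∃ λ t → v ≡ inj₁ t
    inPath (inj₁ t) _ = t , refl
  ... | inj₂ _ = inj₂ λ t → inCrown' (vertex (p t)) (trans (inCrown-invariant path t) (cong inCrown p₀))
    where
    inCrown' : ∀ v → inCrown v ≡ true → ∃ λ c → v ≡ inj₂ c
    inCrown' (inj₂ c) _ = c , refl

  height : Fin N → ℕ
  height u = [ toℕ , const 0 ]′ (vertex u)

  height-pathVertex : ∀ t → height (pathVertex t) ≡ toℕ t
  height-pathVertex t = cong [ toℕ , const 0 ]′ (strictlyInverseˡ (inj₁ t))

  height-oneLipschitz : OneLipschitz G height
  height-oneLipschitz u v edge with vertex u | vertex v
  ... | inj₁ t | inj₁ t' = consecutive⇒≤1+ (toℕ t) (toℕ t') edge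
  ... | inj₂ _ | inj₂ _ = z≤n
  height-oneLipschitz u v () | inj₁ _ | inj₂ _
  height-oneLipschitz u v () | inj₂ _ | inj₁ _

  module Segment (u : Fin (a + a)) (k : ℕ) (u+k<2a : toℕ u + k < a + a) where

    at : Fin (suc k) → Fin (a + a)
    at s = fromℕ< (≤-<-trans (+-monoʳ-≤ (toℕ u) (≤-pred (toℕ<n s))) u+k<2a)

    toℕ-at : ∀ s → toℕ (at s) ≡ toℕ u + toℕ s
    toℕ-at s = toℕ-fromℕ< (≤-<-trans (+-monoʳ-≤ (toℕ u) (≤-pred (toℕ<n s))) u+k<2a)

    segment : Fin (suc k) → Fin N
    segment = pathVertex ∘ at

    segment-path : IsPath G k segment
    segment-path = step , λ eq → toℕ-injective (+-cancelˡ-≡ (toℕ u) _ _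
                     (trans (sym (toℕ-at _)) (trans (cong toℕ (pathVertex-injective eq)) (toℕ-at _))))
      where
      step : ∀ t → adj G (segment (inject₁ t)) (segment (Fin.suc t)) ≡ true
      step t = trans (adj-index (inj₁ (at (inject₁ t))) (inj₁ (at (Fin.suc t))))
        (subst (λ x → consecutive x (toℕ (at (Fin.suc t))) ≡ true)
          (sym (trans (toℕ-at (inject₁ t)) (cong (toℕ u +_) (toℕ-inject₁ t))))
          (subst (λ y → consecutive (toℕ u + toℕ t) y ≡ true)
            (sym (trans (toℕ-at (Fin.suc t)) (+-suc (toℕ u) (toℕ t))))
            (consecutive-suc (toℕ u + toℕ t))))

    segment-shortest : IsShortestPath G k segment
    segment-shortest = potential-geodesic G height height-oneLipschitz segment-path (begin
      height (segment (fromℕ k))  ≡⟨ height-pathVertex (at (fromℕ k)) ⟩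
      toℕ (at (fromℕ k))          ≡⟨ toℕ-at (fromℕ k) ⟩
      toℕ u + toℕ (fromℕ k)       ≡⟨ cong₂ _+_ (sym (+-identityʳ (toℕ u))) (toℕ-fromℕ k) ⟩
      (toℕ u + 0) + k             ≡⟨ cong (_+ k) (sym (trans (height-pathVertex (at 0F)) (toℕ-at 0F))) ⟩
      height (segment 0F) + k ∎)

    segment-visits : ∀ t → toℕ u ≤ toℕ t → toℕ t ≤ toℕ u + k → Visits segment (pathVertex t)
    segment-visits t u≤t t≤u+k = s , cong pathVertex (toℕ-injective (trans (toℕ-at s)
                                      (trans (cong (toℕ u +_) (toℕ-fromℕ< t-u<1+k)) (m+[n∸m]≡n u≤t))))
      where
      t-u<1+k : toℕ t ∸ toℕ u < suc k
      t-u<1+k = s≤s (subst (toℕ t ∸ toℕ u ≤_) (m+n∸m≡n (toℕ u) k) (∸-monoˡ-≤ (toℕ u) t≤u+k))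
      s : Fin (suc k)
      s = fromℕ< t-u<1+k

  pathVertices-commonShortestPath : ∀ {t₁ t₂ t₃} → toℕ t₁ < toℕ t₂ → toℕ t₂ < toℕ t₃ →
    CommonShortestPath G (pathVertex t₁) (pathVertex t₂) (pathVertex t₃)
  pathVertices-commonShortestPath {t₁} {t₂} {t₃} t₁<t₂ t₂<t₃ =
    k , segment , segment-shortest ,
    segment-visits t₁ ≤-refl (m≤m+n _ k) ,
    segment-visits t₂ (<⇒≤ t₁<t₂) (≤-trans (<⇒≤ t₂<t₃) t₃≤) ,
    segment-visits t₃ t₁≤t₃ t₃≤
    where
    t₁≤t₃ = <⇒≤ (<-trans t₁<t₂ t₂<t₃)
    k = toℕ t₃ ∸ toℕ t₁
    t₃≤ : toℕ t₃ ≤ toℕ t₁ + k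
    t₃≤ = ≤-reflexive (sym (m+[n∸m]≡n t₁≤t₃))
    open Segment t₁ k (subst (_< a + a) (sym (m+[n∸m]≡n t₁≤t₃)) (toℕ<n t₃))

  ¬gpColouring-below : ∀ c → c < a → ¬ GpColouring G c
  ¬gpColouring-below c c<a (f , gp)
    with t₁ , t₂ , t₃ , t₁<t₂ , t₂<t₃ , f₁≡f₂ , f₂≡f₃ ← pigeonhole₃ (f ∘ pathVertex) (+-mono-< c<a c<a)
    = commonShortestPath⇒¬gp G (ColourClass G f (f (pathVertex t₂)))
        (pathVertices-commonShortestPath t₁<t₂ t₂<t₃)
        (distinct t₁<t₂) (distinct (<-trans t₁<t₂ t₂<t₃)) (distinct t₂<t₃)
        f₁≡f₂ refl (sym f₂≡f₃) (gp (f (pathVertex t₂)))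
    where
    distinct : ∀ {t t'} → toℕ t < toℕ t' → pathVertex t ≢ pathVertex t'
    distinct t<t' eq = <-irrefl (cong toℕ (pathVertex-injective eq)) t<t'

  zigzagVertex : Bool → (Fin 3 → Fin m) → Fin 5 → Bool × Fin m
  zigzagVertex s ι t = parity t xor s , ι (letter t)

  crownZigzag : Bool → (Fin 3 → Fin m) → Fin 5 → Fin N
  crownZigzag s ι = crownVertex ∘ zigzagVertex s ι

  crownZigzag-induced : ∀ s ι → (∀ {x y} → ι x ≡ ι y → x ≡ y) → IsInducedPath G 4 (crownZigzag s ι)
  crownZigzag-induced s ι ι-injective = (step , injective) , chordless
    where
    v = zigzagVertex s ι
    step : ∀ t → adj G (crownZigzag s ι (inject₁ t)) (crownZigzag s ι (Fin.suc t)) ≡ true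
    step t = trans (adj-crownVertex (v (inject₁ t)) (v (Fin.suc t)))
      (crownAdjacent-true (proj₁ (zigzag-steps t) ∘ xor-injectiveˡ s) (proj₂ (zigzag-steps t) ∘ ι-injective))
    injective : ∀ {x y} → crownZigzag s ι x ≡ crownZigzag s ι y → x ≡ y
    injective {x} {y} eq =
      zigzag-injective x y (cong₂ _,_ (xor-injectiveˡ s (cong proj₁ same)) (ι-injective (cong proj₂ same)))
      where
      same = crownVertex-injective eq
    chordless : ∀ i j → suc (suc (toℕ i)) ≤ toℕ j → adj G (crownZigzag s ι i) (crownZigzag s ι j) ≡ false
    chordless i j gap with zigzag-chords i j gap
    ... | inj₁ sameParity =
      trans (adj-crownVertex (v i) (v j)) (crownAdjacent-sameSide (v i) (v j) (cong (_xor s) sameParity))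
    ... | inj₂ sameLetter =
      trans (adj-crownVertex (v i) (v j)) (crownAdjacent-sameIndex (v i) (v j) (cong ι sameLetter))

  crownZigzag-induced₃ : ∀ s {x y z} → x ≢ y → x ≢ z → y ≢ z → IsInducedPath G 4 (crownZigzag s (three x y z))
  crownZigzag-induced₃ s x≢y x≢z y≢z = crownZigzag-induced s _ (three-injective _ _ _ x≢y x≢z y≢z)

  crown-distance≤3 : 3 ≤ m → ∀ c c' → c ≢ c' →
    ∃ λ d → d ≤ 3 × ∃ λ q → IsPath G d q × q 0F ≡ crownVertex c × q (fromℕ d) ≡ crownVertex c'
  crown-distance≤3 3≤m (s , i) (s' , i') c≢c' with s Bool.≟ s' | i ≟ i'
  ... | yes refl | yes refl = contradiction refl c≢c'
  ... | yes refl | no i≢i' with x , x≢i , x≢i' ← avoid₂ 3≤m i i' =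
    2 , n≤1+n 2 , _ , isPath-prefix G (m≤m+n 2 2) (proj₁ (crownZigzag-induced₃ s (x≢i ∘ sym) i≢i' x≢i')) ,
    refl , refl
  ... | no s≢s' | yes refl with refl ← ¬-not (s≢s' ∘ sym) | x , x≢i , _ ← avoid₂ 3≤m i i
    with y , y≢i , y≢x ← avoid₂ 3≤m i x =
    3 , ≤-refl , _ , isPath-prefix G (n≤1+n 3) (proj₁ (crownZigzag-induced₃ s (x≢i ∘ sym) (y≢i ∘ sym) (y≢x ∘ sym))) ,
    refl , refl
  ... | no s≢s' | no i≢i' with refl ← ¬-not (s≢s' ∘ sym) | x , x≢i , x≢i' ← avoid₂ 3≤m i i' =
    1 , m≤m+n 1 2 , _ , isPath-prefix G (m≤m+n 1 3) (proj₁ (crownZigzag-induced₃ s i≢i' (x≢i ∘ sym) (x≢i' ∘ sym))) ,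
    refl , refl

  private
    threeOnOneSide : ∀ s {i₁ i₂ i₃} → i₁ ≢ i₂ → i₁ ≢ i₃ → i₂ ≢ i₃ →
              CommonInducedPath G (crownVertex (s , i₁)) (crownVertex (s , i₂)) (crownVertex (s , i₃))
    threeOnOneSide s i₁≢i₂ i₁≢i₃ i₂≢i₃ =
      4 , _ , crownZigzag-induced₃ s i₁≢i₂ i₁≢i₃ i₂≢i₃ , (0F , refl) , (4F , refl) , (2F , refl)

    twoOnOneSide : 3 ≤ m → ∀ s {i i'} w → i ≢ i' →
                   CommonInducedPath G (crownVertex (s , i)) (crownVertex (s , i')) (crownVertex (not s , w))
    twoOnOneSide 3≤m s {i} {i'} w i≢i' with w ≟ i | w ≟ i'
    ... | yes refl | _ with x , x≢i , x≢i' ← avoid₂ 3≤m i i' =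
      3 , _ , isInducedPath-prefix G (n≤1+n 3) (crownZigzag-induced₃ s (x≢i ∘ sym) i≢i' x≢i') ,
      (0F , refl) , (2F , refl) , (3F , refl)
    ... | no _ | yes refl with x , x≢i , x≢i' ← avoid₂ 3≤m i i' =
      3 , _ , isInducedPath-prefix G (n≤1+n 3) (crownZigzag-induced₃ s (x≢i' ∘ sym) (i≢i' ∘ sym) x≢i) ,
      (2F , refl) , (0F , refl) , (3F , refl)
    ... | no w≢i | no w≢i' =
      2 , _ , isInducedPath-prefix G (m≤m+n 2 2) (crownZigzag-induced₃ s (w≢i ∘ sym) i≢i' w≢i') ,
      (0F , refl) , (2F , refl) , (1F , refl)

    swap₂₃ : ∀ {u v w} → CommonInducedPath G u v w → CommonInducedPath G u w v
    swap₂₃ (k , p , induced , pu , pv , pw) = k , p , induced , pu , pw , pv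

    rotate : ∀ {u v w} → CommonInducedPath G u v w → CommonInducedPath G w u v
    rotate (k , p , induced , pu , pv , pw) = k , p , induced , pw , pu , pv

  crownVertices-commonInducedPath : 3 ≤ m → ∀ {c₁ c₂ c₃} → c₁ ≢ c₂ → c₁ ≢ c₃ → c₂ ≢ c₃ →
    CommonInducedPath G (crownVertex c₁) (crownVertex c₂) (crownVertex c₃)
  crownVertices-commonInducedPath 3≤m {true , _} {true , _} {true , _} c₁≢c₂ c₁≢c₃ c₂≢c₃ =
    threeOnOneSide true (c₁≢c₂ ∘ cong _) (c₁≢c₃ ∘ cong _) (c₂≢c₃ ∘ cong _)
  crownVertices-commonInducedPath 3≤m {false , _} {false , _} {false , _} c₁≢c₂ c₁≢c₃ c₂≢c₃ =
    threeOnOneSide false (c₁≢c₂ ∘ cong _) (c₁≢c₃ ∘ cong _) (c₂≢c₃ ∘ cong _)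
  crownVertices-commonInducedPath 3≤m {true , _} {true , _} {false , i₃} c₁≢c₂ _ _ =
    twoOnOneSide 3≤m true i₃ (c₁≢c₂ ∘ cong _)
  crownVertices-commonInducedPath 3≤m {false , _} {false , _} {true , i₃} c₁≢c₂ _ _ =
    twoOnOneSide 3≤m false i₃ (c₁≢c₂ ∘ cong _)
  crownVertices-commonInducedPath 3≤m {true , _} {false , i₂} {true , _} _ c₁≢c₃ _ =
    swap₂₃ (twoOnOneSide 3≤m true i₂ (c₁≢c₃ ∘ cong _))
  crownVertices-commonInducedPath 3≤m {false , _} {true , i₂} {false , _} _ c₁≢c₃ _ =
    swap₂₃ (twoOnOneSide 3≤m false i₂ (c₁≢c₃ ∘ cong _))
  crownVertices-commonInducedPath 3≤m {false , i₁} {true , _} {true , _} _ _ c₂≢c₃ =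
    rotate (twoOnOneSide 3≤m true i₁ (c₂≢c₃ ∘ cong _))
  crownVertices-commonInducedPath 3≤m {true , i₁} {false , _} {false , _} _ _ c₂≢c₃ =
    rotate (twoOnOneSide 3≤m false i₁ (c₂≢c₃ ∘ cong _))

  ¬mpColouring-below : 3 ≤ m → ∀ c → c < m → ¬ MpColouring G c
  ¬mpColouring-below 3≤m c c<m (f , mp)
    with t₁ , t₂ , t₃ , t₁<t₂ , t₂<t₃ , f₁≡f₂ , f₂≡f₃
           ← pigeonhole₃ (f ∘ crownVertex ∘ Inverse.to crownVertices)
                         (subst (c + c <_) (cong (m +_) (sym (+-identityʳ m))) (+-mono-< c<m c<m))
    = commonInducedPath⇒¬mp G (ColourClass G f (f (crownVertex (Inverse.to crownVertices t₂))))
        (crownVertices-commonInducedPath 3≤m (distinct t₁<t₂) (distinct t₁<t₃) (distinct t₂<t₃))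
        (distinct t₁<t₂ ∘ crownVertex-injective) (distinct t₁<t₃ ∘ crownVertex-injective)
        (distinct t₂<t₃ ∘ crownVertex-injective)
        f₁≡f₂ refl (sym f₂≡f₃) (mp _)
    where
    t₁<t₃ = <-trans t₁<t₂ t₂<t₃
    distinct : ∀ {t t'} → toℕ t < toℕ t' → Inverse.to crownVertices t ≢ Inverse.to crownVertices t'
    distinct t<t' eq = <-irrefl (cong toℕ (Injection.injective (Inverse⇒Injection crownVertices) eq)) t<t'

  module Colouring {c} (a≤c : a ≤ c) (crownColour : Bool × Fin m → Fin c) where

    halfColour : Fin (a + a) → Fin c
    halfColour t = fromℕ< (<-≤-trans (⌊n/2⌋<m (toℕ<n t)) a≤c)

    colour : Fin N → Fin c
    colour u = [ halfColour , crownColour ]′ (vertex u)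

    colour-onPath : ∀ {u t} → vertex u ≡ inj₁ t → colour u ≡ halfColour t
    colour-onPath = cong [ halfColour , crownColour ]′

    colour-onCrown : ∀ {u c} → vertex u ≡ inj₂ c → colour u ≡ crownColour c
    colour-onCrown = cong [ halfColour , crownColour ]′

    PathClass CrownClass : Fin c → Fin N → Set
    PathClass x u = colour u ≡ x × InPath u
    CrownClass x u = colour u ≡ x × InCrown u

    pathClass-atMostTwo : ∀ x → AtMostTwo (PathClass x)
    pathClass-atMostTwo x = atMostTwo-map height injective halves (⌊n/2⌋-atMostTwo (toℕ x))
      where
      height-onPath : ∀ {u t} → vertex u ≡ inj₁ t → height u ≡ toℕ t
      height-onPath = cong [ toℕ , const 0 ]′
      injective : ∀ {u v} → PathClass x u → PathClass x v → height u ≡ height v → u ≡ v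
      injective (_ , t , eu) (_ , t' , ev) eq = vertex-injective (trans eu (trans (cong inj₁ t≡t') (sym ev)))
        where
        t≡t' = toℕ-injective (trans (sym (height-onPath eu)) (trans eq (height-onPath ev)))
      halves : ∀ {u} → PathClass x u → ⌊ height u /2⌋ ≡ toℕ x
      halves {u} (cu , t , eu) = begin
        ⌊ height u /2⌋         ≡⟨ cong ⌊_/2⌋ (height-onPath eu) ⟩
        ⌊ toℕ t /2⌋            ≡⟨ toℕ-fromℕ< _ ⟨
        toℕ (halfColour t)     ≡⟨ cong toℕ (trans (sym (colour-onPath eu)) cu) ⟩
        toℕ x                  ∎

    path-noMonochromaticTriple : ∀ x {k p} → IsPath G k p → (∀ t → InPath (p t)) →
                                 ¬ ThreeOnPath G (ColourClass G colour x) k p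
    path-noMonochromaticTriple x path onPath =
      atMostTwo⇒¬threeOnPath G {PathClass x} path (pathClass-atMostTwo x)
      ∘ threeOnPath-restrict G {ColourClass G colour x} {T = InPath} onPath

  mpColouring : ∀ {c} → a ≤ c → m ≤ c → MpColouring G c
  mpColouring {c} a≤c m≤c = colour , valid
    where
    indexColour : Bool × Fin m → Fin c
    indexColour (_ , i) = fromℕ< (<-≤-trans (toℕ<n i) m≤c)
    open Colouring a≤c indexColour
    side : Fin N → Bool
    side u = [ const true , proj₁ ]′ (vertex u)
    -- An equally coloured crown vertex is determined by its side.
    crownClass-atMostTwo : ∀ x → AtMostTwo (CrownClass x)
    crownClass-atMostTwo x =
      atMostTwo-map side injective (λ {u} _ → true-or-false (side u)) (atMostTwo-twoValues true false)
      where
      true-or-false : ∀ b → b ≡ true ⊎ b ≡ false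
      true-or-false true = inj₁ refl
      true-or-false false = inj₂ refl
      injective : ∀ {u v} → CrownClass x u → CrownClass x v → side u ≡ side v → u ≡ v
      injective (cu , (s , i) , eu) (cv , (s' , i') , ev) eq =
        vertex-injective (trans eu (trans (cong inj₂ same) (sym ev)))
        where
        sameColour : indexColour (s , i) ≡ indexColour (s' , i')
        sameColour = trans (sym (colour-onCrown eu)) (trans cu (trans (sym cv) (colour-onCrown ev)))
        same : (s , i) ≡ (s' , i')
        same = cong₂ _,_ (trans (sym (cong [ const true , proj₁ ]′ eu)) (trans eq (cong [ const true , proj₁ ]′ ev)))
                         (toℕ-injective (trans (sym (toℕ-fromℕ< _)) (trans (cong toℕ sameColour) (toℕ-fromℕ< _))))
    valid : ∀ x → InMonophonicPosition G (ColourClass G colour x)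
    valid x k p (path , _) with path-within-component path
    ... | inj₁ onPath = path-noMonochromaticTriple x path onPath
    ... | inj₂ onCrown = atMostTwo⇒¬threeOnPath G {CrownClass x} path (crownClass-atMostTwo x)
                         ∘ threeOnPath-restrict G {ColourClass G colour x} {T = InCrown} onCrown

  crown-shortestPath≤3 : 3 ≤ m → ∀ {k p} → IsShortestPath G k p → (∀ t → InCrown (p t)) → 0 < k → k ≤ 3
  crown-shortestPath≤3 3≤m {k} {p} (path , shortest) onCrown 0<k
    with c₀ , e₀ ← onCrown 0F | cₖ , eₖ ← onCrown (fromℕ k)
    with d , d≤3 , q , q-path , q₀ , q_d ← crown-distance≤3 3≤m c₀ cₖ
           (λ c₀≡cₖ → endpoints-distinct G path 0<k (vertex-injective (trans e₀ (trans (cong inj₂ c₀≡cₖ) (sym eₖ)))))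
    = ≤-trans (shortest d q q-path (trans q₀ (sym (vertex≡⇒≡index e₀))) (trans q_d (sym (vertex≡⇒≡index eₖ))))
              d≤3

  -- The hypothesis is vacuous for the empty crown (m = 0), which is the case a = b.
  gpColouring : (Fin m → 2 ≤ a × 3 ≤ m) → GpColouring G a
  gpColouring nonempty = colour , valid
    where
    crownColour : Bool × Fin m → Fin a
    crownColour (s , i) = sideColour (proj₁ (nonempty i)) s
    open Colouring ≤-refl crownColour
    crownClass-independent : ∀ x → Independent G (CrownClass x)
    crownClass-independent x u v (cu , (s , i) , eu) (cv , (s' , i') , ev) =
      trans (cong₂ adjacent eu ev) (crownAdjacent-sameSide (s , i) (s' , i') (sideColour-injective
        (trans (sym (colour-onCrown eu)) (trans cu (trans (sym cv) (colour-onCrown ev))))))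
    valid : ∀ x → InGeneralPosition G (ColourClass G colour x)
    valid x k p shortest three with path-within-component (proj₁ shortest)
    ... | inj₁ onPath = path-noMonochromaticTriple x (proj₁ shortest) onPath three
    ... | inj₂ onCrown = independent⇒¬threeOnShortPath G (crownClass-independent x) k≤3 (proj₁ shortest)
                           (threeOnPath-restrict G {ColourClass G colour x} {T = InCrown} onCrown three)
      where
      k≤3 : k ≤ 3
      k≤3 = crown-shortestPath≤3 (proj₂ (nonempty (proj₂ (proj₁ (onCrown 0F))))) shortest onCrown
              (≤-trans (s≤s z≤n) (threeOnPath⇒2≤k G (ColourClass G colour x) three))

-- Chromatic numbers

Realisable : ℕ → ℕ → Set
Realisable a b = Σ ℕ λ n → Σ (Graph n) λ G → ChiGpIs G a × ChiMpIs G b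

module _ {n : ℕ} {G : Graph n} where

  χgp≤χmp : ∀ {a b} → ChiGpIs G a → ChiMpIs G b → a ≤ b
  χgp≤χmp (_ , gp-minimal) (mp , _) = ≮⇒≥ λ b<a → gp-minimal _ b<a (mpColouring⇒gpColouring G mp)

  χgp≡1⇒χmp≤1 : ∀ {b} → ChiGpIs G 1 → ChiMpIs G b → b ≤ 1
  χgp≡1⇒χmp≤1 ((f , gp) , _) (_ , mp-minimal) =
    ≮⇒≥ λ 1<b → mp-minimal 1 1<b (f , λ x → everywhere-gp⇒mp G (λ v → single (f v) x) (gp x))
    where
    single : ∀ (x y : Fin 1) → x ≡ y
    single 0F 0F = refl

realisable⇒ : ∀ {a b} → 1 ≤ a → 1 ≤ b → Realisable a b → (a ≡ 1 × b ≡ 1) ⊎ (2 ≤ a × a ≤ b)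
realisable⇒ {1} _ 1≤b (_ , G , χgp , χmp) = inj₁ (refl , ≤-antisym (χgp≡1⇒χmp≤1 {G = G} χgp χmp) 1≤b)
realisable⇒ {suc (suc _)} _ _ (_ , G , χgp , χmp) = inj₂ (s≤s (s≤s z≤n) , χgp≤χmp {G = G} χgp χmp)

diagonal-realisable : ∀ a → Realisable a a
diagonal-realisable a = N , G , (gpColouring (λ ()) , ¬gpColouring-below) ,
  (mpColouring ≤-refl z≤n , λ c c<a → ¬gpColouring-below c c<a ∘ mpColouring⇒gpColouring G)
  where
  open PathCrown a 0

offDiagonal-realisable : ∀ {a b} → 2 ≤ a → a < b → Realisable a b
offDiagonal-realisable {a} {b} 2≤a a<b = N , G ,
  (gpColouring (λ _ → 2≤a , 3≤b) , ¬gpColouring-below) , (mpColouring (<⇒≤ a<b) ≤-refl , ¬mpColouring-below 3≤b)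
  where
  open PathCrown a b
  3≤b : 3 ≤ b
  3≤b = ≤-trans (s≤s 2≤a) a<b

⇒realisable : ∀ {a b} → (a ≡ 1 × b ≡ 1) ⊎ (2 ≤ a × a ≤ b) → Realisable a b
⇒realisable (inj₁ (refl , refl)) = diagonal-realisable 1
⇒realisable (inj₂ (2≤a , a≤b)) with m≤n⇒m<n∨m≡n a≤b
... | inj₁ a<b = offDiagonal-realisable 2≤a a<b
... | inj₂ refl = diagonal-realisable _

mainTheorem8 : (a b : ℕ) → 1 ≤ a → 1 ≤ b →
    (Σ ℕ (λ n → Σ (Graph n) (λ G → ChiGpIs G a × ChiMpIs G b)))
      ⇔ ((a ≡ 1 × b ≡ 1) ⊎ (2 ≤ a × a ≤ b))
mainTheorem8 a b 1≤a 1≤b = mk⇔ (realisable⇒ 1≤a 1≤b) ⇒realisable
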